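{- Let $G$ be the Hermitian forms graph of diameter $d\ge2$ over $\mathrm{GF}(q^2)$, with eigenvalues $\theta_i=((-q)^{2d-i}-1)/(q+1)$, $i=0,\dots,d$. Then \[ \max_{1\le j\le d}\left\{\frac{1-w_d(\theta_j)}{1-w_1(\theta_j)}\right\}=\frac{1-w_d(\theta_2)}{1-w_1(\theta_2)}. \]
   Context: The Hermitian forms graph has as vertices the $d\times d$ Hermitian matrices over $\mathrm{GF}(q^2)$, two being adjacent iff their difference has rank $1$; it is distance-regular of diameter $d$ (classical parameters $(d,-q,-q-1,-(-q)^d-1)$), with distinct adjacency eigenvalues $\theta_i=((-q)^{2d-i}-1)/(q+1)$, $0\le i\le d$. For a distance-regular graph with valency $k$ and intersection numbers $b_i,c_i$, $a_i=k-b_i-c_i$, the cosine sequence of an eigenvalue $\theta$ is defined by $w_0(\theta)=1$, $w_1(\theta)=\theta/k$, $c_iw_{i-1}(\theta)+a_iw_i(\theta)+b_iw_{i+1}(\theta)=\theta w_i(\theta)$ ($1\le i\le d-1$). -}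

module Defs where

open import Data.Nat as ℕ using (ℕ; zero; suc)
open import Data.Integer as ℤ using (ℤ; +_)
open import Data.Rational using (ℚ; 0ℚ; 1ℚ; _/_; _+_; _*_; _-_; _÷_; -_; _⊔_; ≢-nonZero)
open import Data.Rational.Properties using (_≟_)
open import Data.Product using (_×_; _,_; proj₁)
open import Relation.Nullary using (yes; no)

-- Total division on ℚ: x ÷ y when y ≠ 0, and 0 otherwise.
-- (Only ever applied below to nonzero denominators.)
safeDiv : ℚ → ℚ → ℚ
safeDiv x y with y ≟ 0ℚ
... | yes _ = 0ℚ
... | no y≢0 = _÷_ x y {{≢-nonZero y≢0}}

ι : ℤ → ℚ
ι z = z / 1

-- Intersection arrays of a distance-regular graph with classical
-- parameters (d, b, α, β)  (Brouwer–Cohen–Neumaier, Cor. 8.4.2):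
--   [i]  = 1 + b + ... + b^(i-1)
--   b_i  = ([d] - [i]) (β - α [i])
--   c_i  = [i] (1 + α [i-1])

gbin : ℚ → ℕ → ℚ
gbin b zero    = 0ℚ
gbin b (suc i) = 1ℚ + b * gbin b i

record IntersectionNumbers : Set where
  field
    bᵢ : ℕ → ℚ
    cᵢ : ℕ → ℚ

classicalIN : ℕ → ℚ → ℚ → ℚ → IntersectionNumbers
classicalIN d b α β = record
  { bᵢ = λ i → (gbin b d - gbin b i) * (β - α * gbin b i)
  ; cᵢ = λ i → gbin b i * (1ℚ + α * gbin b (i ℕ.∸ 1))
  }

hermitianIN : (q d : ℕ) → IntersectionNumbers
hermitianIN q d =
  classicalIN d (ι (ℤ.- (+ q))) (ι (ℤ.- (+ q) ℤ.- ℤ.1ℤ))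
                (ι (ℤ.- ((ℤ.- (+ q)) ℤ.^ d) ℤ.- ℤ.1ℤ))

valency : IntersectionNumbers → ℚ
valency I = IntersectionNumbers.bᵢ I 0

aᵢ : IntersectionNumbers → ℕ → ℚ
aᵢ I i = valency I - IntersectionNumbers.bᵢ I i - IntersectionNumbers.cᵢ I i

-- Cosine sequence of θ: w₀ = 1, w₁ = θ/k,
--   c_i w_{i-1} + a_i w_i + b_i w_{i+1} = θ w_i   (i ≥ 1),
-- i.e. w_{i+1} = ((θ - a_i) w_i - c_i w_{i-1}) / b_i.
-- cosPair I θ i = (w_i , w_{i+1}).
cosPair : IntersectionNumbers → ℚ → ℕ → ℚ × ℚ
cosPair I θ zero = 1ℚ , safeDiv θ (valency I)
cosPair I θ (suc i) with cosPair I θ i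
... | (wprev , wcur) =
  wcur ,
  safeDiv ((θ - aᵢ I (suc i)) * wcur - IntersectionNumbers.cᵢ I (suc i) * wprev)
          (IntersectionNumbers.bᵢ I (suc i))

cosine : IntersectionNumbers → ℚ → ℕ → ℚ
cosine I θ i = proj₁ (cosPair I θ i)

hermitianEigenvalue : (q d i : ℕ) → ℚ
hermitianEigenvalue q d i =
  ((ℤ.- (+ q)) ℤ.^ (2 ℕ.* d ℕ.∸ i) ℤ.- ℤ.1ℤ) / suc q

ratio : (q d j : ℕ) → ℚ
ratio q d j =
  safeDiv (1ℚ - cosine (hermitianIN q d) (hermitianEigenvalue q d j) d)
          (1ℚ - cosine (hermitianIN q d) (hermitianEigenvalue q d j) 1)

-- max_{1 ≤ j ≤ n} f j   (for n ≥ 1; value f 1 when n = 0, unused)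
maxFrom1 : (ℕ → ℚ) → ℕ → ℚ
maxFrom1 f zero          = f 1
maxFrom1 f (suc zero)    = f 1
maxFrom1 f (suc (suc n)) = maxFrom1 f (suc n) ⊔ f (suc (suc n))

{-# OPTIONS --safe #-}

-- Scaling the cosine recurrence of the classical parameters (d, b, b - 1, -b^d - 1) by b (1 - b)
-- turns it into a polynomial recurrence in b, b^d, b^i and T = 1 + (1 - b) θ; for the Hermitian
-- forms graph b = -q and θ_j has T = b^(2d-j).  The cosine sequences U of θ_(j+1) (diameter e + 1)
-- and Y of θ_j (diameter e) are contiguous:
--   (b^(2d) - 1) b^i U_i = (b^(2d) - b^(2i)) Y_i - b^i (1 - b^i) Y_(i-1),
-- a relation that propagates along both recurrences by a polynomial identity.  At i = d it shows
-- that θ_(j+1) satisfies the last equation of the recurrence whenever θ_j does, and that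
-- (1 + b^d) w_d(θ_(j+1)) = w_(d-1)(θ_j); hence w_d(θ_j) = ∏_(d-j < k ≤ d) 1 / (1 + (-q)^k).
-- As w_1(θ_j) = θ_j / k, the ratio equals (1 - q^(-2d)) (1 - w_d(θ_j)) b^j / (b^j - 1).  For j = 2
-- this is at least q² / (q² - 1), because w_d(θ_2) < 0; for odd j, and for even j ≥ 4, the bounds
-- |w_d(θ_j)| ≤ 1 / (q^d - 1), resp. ≤ 1 / ((q^d - 1)(q^(d-1) - 1)), keep it below q² / (q² - 1).

module Submission where

open import Algebra.Bundles using (CommutativeRing)
open import Data.Integer as ℤ using (ℤ; +_)
import Data.Integer.Properties as ℤ
open import Data.Nat as ℕ using (ℕ; zero; suc; _∸_)
import Data.Nat.Coprimality as Coprime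
import Data.Nat.Properties as ℕ
open import Data.Nat.Primality using (Prime; prime⇒nonTrivial)
open import Data.Product using (_×_; _,_; proj₁; proj₂; ∃₂)
open import Data.Sum using (_⊎_; inj₁; inj₂)
open import Data.Rational
open import Data.Rational.Properties
open import Data.Rational.Unnormalised as ℚᵘ using (mkℚᵘ)
import Data.Rational.Unnormalised.Properties as ℚᵘ
open import Level using (0ℓ)
open import Relation.Binary.PropositionalEquality
open import Relation.Nullary using (yes; no)
open import Relation.Nullary.Decidable.Core using (dec⇒maybe)
open import Relation.Nullary.Negation using (contradiction)
open import Tactic.RingSolver using (solve-∀)
open import Tactic.RingSolver.Core.AlmostCommutativeRing using (AlmostCommutativeRing; fromCommutativeRing)

open import Defs

open import Algebra.Properties.Semiring.Exp (CommutativeRing.semiring +-*-commutativeRing)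
  using (_^_; ^-homo-*)
open import Algebra.Properties.Group (CommutativeRing.+-group +-*-commutativeRing)
  using (x∙y⁻¹≈ε⇒x≈y; ⁻¹-involutive)

open IntersectionNumbers

-- A genuine zero test is needed: with the trivial one the solver's normal forms are not canonical.
ℚ-ring : AlmostCommutativeRing 0ℓ 0ℓ
ℚ-ring = fromCommutativeRing +-*-commutativeRing (λ x → dec⇒maybe (0ℚ ≟ x))

*-cancelʳ-≢0 : ∀ {x y} c → c ≢ 0ℚ → x * c ≡ y * c → x ≡ y
*-cancelʳ-≢0 {x} {y} c c≢0 xc≡yc = begin
  x                ≡⟨ undo x ⟨
  x * c * (1/ c)   ≡⟨ cong (_* (1/ c)) xc≡yc ⟩
  y * c * (1/ c)   ≡⟨ undo y ⟩
  y                ∎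
  where
  open ≡-Reasoning
  instance
    c-nonZero : NonZero c
    c-nonZero = ≢-nonZero c≢0
  undo : ∀ z → z * c * (1/ c) ≡ z
  undo z = trans (*-assoc z c (1/ c)) (trans (cong (z *_) (*-inverseʳ c)) (*-identityʳ z))

*-≡0-cancelˡ : ∀ {c x} → c ≢ 0ℚ → c * x ≡ 0ℚ → x ≡ 0ℚ
*-≡0-cancelˡ {c} {x} c≢0 cx≡0 = *-cancelʳ-≢0 c c≢0 (trans (*-comm x c) (trans cx≡0 (sym (*-zeroˡ c))))

*-≢0 : ∀ {x y} → x ≢ 0ℚ → y ≢ 0ℚ → x * y ≢ 0ℚ
*-≢0 x≢0 y≢0 xy≡0 = y≢0 (*-≡0-cancelˡ x≢0 xy≡0)

safeDiv-* : ∀ x {y} → y ≢ 0ℚ → safeDiv x y * y ≡ x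
safeDiv-* x {y} y≢0 with y ≟ 0ℚ
... | yes y≡0 = contradiction y≡0 y≢0
... | no y≢0′ = trans (*-assoc x (1/ y) y) (trans (cong (x *_) (*-inverseˡ y)) (*-identityʳ x))
  where
  instance
    y-nonZero : NonZero y
    y-nonZero = ≢-nonZero y≢0′

*-nonNeg : ∀ {x y} → 0ℚ ≤ x → 0ℚ ≤ y → 0ℚ ≤ x * y
*-nonNeg {x} {y} 0≤x 0≤y = nonNegative⁻¹ (x * y) {{nonNeg*nonNeg⇒nonNeg x {{nonNegative 0≤x}} y {{nonNegative 0≤y}}}}

≤-from-difference : ∀ {x y c} → y - x ≡ c → 0ℚ ≤ c → x ≤ y
≤-from-difference {x} {y} {c} y-x≡c 0≤c = begin
  x           ≡⟨ +-identityˡ x ⟨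
  0ℚ + x      ≤⟨ +-monoˡ-≤ x 0≤c ⟩
  c + x       ≡⟨ cong (_+ x) y-x≡c ⟨
  y - x + x   ≡⟨ cancel x y ⟩
  y           ∎
  where
  open ≤-Reasoning
  cancel : ∀ x y → y - x + x ≡ y
  cancel = solve-∀ ℚ-ring

difference-nonNeg : ∀ {x y} → x ≤ y → 0ℚ ≤ y - x
difference-nonNeg {x} {y} x≤y = ≤-trans (≤-reflexive (sym (+-inverseʳ x))) (+-monoˡ-≤ (- x) x≤y)

0≤p+∣p∣ : ∀ p → 0ℚ ≤ p + ∣ p ∣
0≤p+∣p∣ p with ∣p∣≡p∨∣p∣≡-p p
... | inj₁ ∣p∣≡p = +-mono-≤ (≤-trans (0≤∣p∣ p) (≤-reflexive ∣p∣≡p)) (0≤∣p∣ p)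
... | inj₂ ∣p∣≡-p = ≤-reflexive (sym (trans (cong (λ x → p + x) ∣p∣≡-p) (+-inverseʳ p)))

≤-by-positive-factor : ∀ {x y z} → 0ℚ < z → x * z ≤ y * z → x ≤ y
≤-by-positive-factor {z = z} 0<z = *-cancelʳ-≤-pos z {{positive 0<z}}

0<-from-1≤ : ∀ {x} → 1ℚ ≤ x → 0ℚ < x
0<-from-1≤ = <-≤-trans (positive⁻¹ 1ℚ)

*-pos : ∀ {x y} → 0ℚ < x → 0ℚ < y → 0ℚ < x * y
*-pos {x} {y} 0<x 0<y = positive⁻¹ (x * y) {{pos*pos⇒pos x {{positive 0<x}} y {{positive 0<y}}}}

ι-mkℚ : ∀ z → ι z ≡ mkℚ z 0 (Coprime.sym (Coprime.1-coprimeTo ℤ.∣ z ∣))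
ι-mkℚ z = ↥p/↧p≡p (mkℚ z 0 (Coprime.sym (Coprime.1-coprimeTo ℤ.∣ z ∣)))

ι-+ : ∀ x y → ι (x ℤ.+ y) ≡ ι x + ι y
ι-+ x y rewrite ι-mkℚ x | ι-mkℚ y = cong (_/ 1) (sym (cong₂ ℤ._+_ (ℤ.*-identityʳ x) (ℤ.*-identityʳ y)))

ι-* : ∀ x y → ι (x ℤ.* y) ≡ ι x * ι y
ι-* x y rewrite ι-mkℚ x | ι-mkℚ y = refl

ι-neg : ∀ x → ι (ℤ.- x) ≡ - ι x
ι-neg x = begin
  ι (ℤ.- x)        ≡⟨ cong ι (ℤ.-1*i≡-i x) ⟨
  ι (ℤ.-1ℤ ℤ.* x)  ≡⟨ ι-* ℤ.-1ℤ x ⟩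
  - 1ℚ * ι x       ≡⟨ neg-distribˡ-* 1ℚ (ι x) ⟨
  - (1ℚ * ι x)     ≡⟨ cong -_ (*-identityˡ (ι x)) ⟩
  - ι x            ∎
  where open ≡-Reasoning

ι-- : ∀ x y → ι (x ℤ.- y) ≡ ι x - ι y
ι-- x y = trans (ι-+ x (ℤ.- y)) (cong (λ t → ι x + t) (ι-neg y))

ι-^ : ∀ x n → ι (x ℤ.^ n) ≡ ι x ^ n
ι-^ x zero = refl
ι-^ x (suc n) = trans (ι-* x (x ℤ.^ n)) (cong (ι x *_) (ι-^ x n))

ι-mono : ∀ {m n} → m ℕ.≤ n → ι (+ m) ≤ ι (+ n)
ι-mono {m} {n} m≤n rewrite ι-mkℚ (+ m) | ι-mkℚ (+ n) =
  *≤* (ℤ.*-monoʳ-≤-nonNeg (+ 1) (ℤ.+≤+ m≤n))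

/-*-denominator : ∀ z n → (z / suc n) * ι (+ suc n) ≡ ι z
/-*-denominator z n = begin
  fromℚᵘ x * fromℚᵘ y
    ≡⟨ fromℚᵘ-toℚᵘ (fromℚᵘ x * fromℚᵘ y) ⟨
  fromℚᵘ (toℚᵘ (fromℚᵘ x * fromℚᵘ y))
    ≡⟨ fromℚᵘ-cong (toℚᵘ-homo-* (fromℚᵘ x) (fromℚᵘ y)) ⟩
  fromℚᵘ (toℚᵘ (fromℚᵘ x) ℚᵘ.* toℚᵘ (fromℚᵘ y))
    ≡⟨ fromℚᵘ-cong (ℚᵘ.*-cong (toℚᵘ-fromℚᵘ x) (toℚᵘ-fromℚᵘ y)) ⟩
  fromℚᵘ (x ℚᵘ.* y)
    ≡⟨ fromℚᵘ-cong {x ℚᵘ.* y} {mkℚᵘ z 0} (ℚᵘ.*≡* cross-multiplied) ⟩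
  fromℚᵘ (mkℚᵘ z 0) ∎
  where
  open ≡-Reasoning
  x y : ℚᵘ.ℚᵘ
  x = mkℚᵘ z n
  y = mkℚᵘ (+ suc n) 0
  cross-multiplied : (z ℤ.* + suc n) ℤ.* + 1 ≡ z ℤ.* + suc (n ℕ.* 1)
  cross-multiplied rewrite ℕ.*-identityʳ n = ℤ.*-identityʳ (z ℤ.* + suc n)

cosine-recurrence : ∀ I θ i → bᵢ I i ≢ 0ℚ →
  bᵢ I i * cosine I θ (suc i) - (θ - aᵢ I i) * cosine I θ i + cᵢ I i * cosine I θ (i ∸ 1) ≡ 0ℚ
cosine-recurrence I θ zero k≢0 = begin
  k * safeDiv θ k - (θ - (k - k - c)) * 1ℚ + c * 1ℚ
    ≡⟨ cong (λ x → x - (θ - (k - k - c)) * 1ℚ + c * 1ℚ) (trans (*-comm k (safeDiv θ k)) (safeDiv-* θ k≢0)) ⟩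
  θ - (θ - (k - k - c)) * 1ℚ + c * 1ℚ
    ≡⟨ cancel θ k c ⟩
  0ℚ ∎
  where
  open ≡-Reasoning
  k c : ℚ
  k = valency I
  c = cᵢ I 0
  cancel : ∀ θ k c → θ - (θ - (k - k - c)) * 1ℚ + c * 1ℚ ≡ 0ℚ
  cancel = solve-∀ ℚ-ring
cosine-recurrence I θ (suc i) bᵢ≢0 = begin
  B * safeDiv X B - X′ + C * w₋
    ≡⟨ cong (λ x → x - X′ + C * w₋) (trans (*-comm B (safeDiv X B)) (safeDiv-* X bᵢ≢0)) ⟩
  X - X′ + C * w₋
    ≡⟨ cancel X′ (C * w₋) ⟩
  0ℚ ∎
  where
  open ≡-Reasoning
  B C w₋ X′ X : ℚ
  B = bᵢ I (suc i)
  C = cᵢ I (suc i)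
  w₋ = cosine I θ i
  X′ = (θ - aᵢ I (suc i)) * cosine I θ (suc i)
  X = X′ - C * w₋
  cancel : ∀ x y → x - y - x + y ≡ 0ℚ
  cancel = solve-∀ ℚ-ring

gbin-closed : ∀ b n → (1ℚ - b) * gbin b n ≡ 1ℚ - b ^ n
gbin-closed b zero = vanish b
  where
  vanish : ∀ b → (1ℚ - b) * 0ℚ ≡ 1ℚ - 1ℚ
  vanish = solve-∀ ℚ-ring
gbin-closed b (suc n) = begin
  (1ℚ - b) * (1ℚ + b * gbin b n)   ≡⟨ expand b (gbin b n) ⟩
  1ℚ - b + b * ((1ℚ - b) * gbin b n) ≡⟨ cong (λ t → 1ℚ - b + b * t) (gbin-closed b n) ⟩
  1ℚ - b + b * (1ℚ - b ^ n)          ≡⟨ collect b (b ^ n) ⟩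
  1ℚ - b * b ^ n                     ∎
  where
  open ≡-Reasoning
  expand : ∀ b g → (1ℚ - b) * (1ℚ + b * g) ≡ 1ℚ - b + b * ((1ℚ - b) * g)
  expand = solve-∀ ℚ-ring
  collect : ∀ b p → 1ℚ - b + b * (1ℚ - p) ≡ 1ℚ - b * p
  collect = solve-∀ ℚ-ring

classical : ℚ → ℕ → IntersectionNumbers
classical b d = classicalIN d b (b - 1ℚ) (- (b ^ d) - 1ℚ)

classical-bᵢ : ∀ b d i → (1ℚ - b) * bᵢ (classical b d) i ≡ b ^ d * b ^ d - b ^ i * b ^ i
classical-bᵢ b d i = begin
  (1ℚ - b) * ((gbin b d - gbin b i) * ((- D - 1ℚ) - (b - 1ℚ) * gbin b i))
    ≡⟨ distribute b (gbin b d) (gbin b i) D ⟩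
  ((1ℚ - b) * gbin b d - (1ℚ - b) * gbin b i) * (- D - 1ℚ + (1ℚ - b) * gbin b i)
    ≡⟨ cong₂ (λ x y → (x - y) * (- D - 1ℚ + y)) (gbin-closed b d) (gbin-closed b i) ⟩
  ((1ℚ - D) - (1ℚ - p)) * (- D - 1ℚ + (1ℚ - p))
    ≡⟨ difference-of-squares D p ⟩
  D * D - p * p ∎
  where
  open ≡-Reasoning
  D p : ℚ
  D = b ^ d
  p = b ^ i
  distribute : ∀ b x y D → (1ℚ - b) * ((x - y) * ((- D - 1ℚ) - (b - 1ℚ) * y))
                         ≡ ((1ℚ - b) * x - (1ℚ - b) * y) * (- D - 1ℚ + (1ℚ - b) * y)
  distribute = solve-∀ ℚ-ring
  difference-of-squares : ∀ D p → ((1ℚ - D) - (1ℚ - p)) * (- D - 1ℚ + (1ℚ - p)) ≡ D * D - p * p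
  difference-of-squares = solve-∀ ℚ-ring

classical-cᵢ : ∀ b d i → b * (1ℚ - b) * cᵢ (classical b d) i ≡ b ^ i * (1ℚ - b ^ i)
classical-cᵢ b d zero = vanish b (1ℚ + (b - 1ℚ) * 0ℚ)
  where
  vanish : ∀ b x → b * (1ℚ - b) * (0ℚ * x) ≡ 1ℚ * (1ℚ - 1ℚ)
  vanish = solve-∀ ℚ-ring
classical-cᵢ b d (suc i) = begin
  b * (1ℚ - b) * ((1ℚ + b * gbin b i) * (1ℚ + (b - 1ℚ) * gbin b i))
    ≡⟨ distribute b (gbin b i) ⟩
  b * (1ℚ - b * (1ℚ - (1ℚ - b) * gbin b i)) * (1ℚ - (1ℚ - b) * gbin b i)
    ≡⟨ cong (λ y → b * (1ℚ - b * (1ℚ - y)) * (1ℚ - y)) (gbin-closed b i) ⟩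
  b * (1ℚ - b * (1ℚ - (1ℚ - b ^ i))) * (1ℚ - (1ℚ - b ^ i))
    ≡⟨ collect b (b ^ i) ⟩
  b * b ^ i * (1ℚ - b * b ^ i) ∎
  where
  open ≡-Reasoning
  distribute : ∀ b y → b * (1ℚ - b) * ((1ℚ + b * y) * (1ℚ + (b - 1ℚ) * y))
                     ≡ b * (1ℚ - b * (1ℚ - (1ℚ - b) * y)) * (1ℚ - (1ℚ - b) * y)
  distribute = solve-∀ ℚ-ring
  collect : ∀ b p → b * (1ℚ - b * (1ℚ - (1ℚ - p))) * (1ℚ - (1ℚ - p)) ≡ b * p * (1ℚ - b * p)
  collect = solve-∀ ℚ-ring

-- b (1 - b) times the defect of the i-th cosine equation, with D = b^d, p = b^i, T = 1 + (1 - b) θ.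
defect : (b D p T w₋ w₀ w₊ : ℚ) → ℚ
defect b D p T w₋ w₀ w₊ =
  b * (D * D - p * p) * w₊ - (b * (T - 1ℚ) - (p - 1ℚ) * (b * p + b + p)) * w₀ + p * (1ℚ - p) * w₋

classical-defect : ∀ b d i {θ T} → (1ℚ - b) * θ ≡ T - 1ℚ → ∀ w₋ w₀ w₊ →
  defect b (b ^ d) (b ^ i) T w₋ w₀ w₊ ≡
  b * (1ℚ - b) * (bᵢ (classical b d) i * w₊ - (θ - aᵢ (classical b d) i) * w₀
                  + cᵢ (classical b d) i * w₋)
classical-defect b d i {θ} {T} θ≡ w₋ w₀ w₊ = sym (begin
  b * (1ℚ - b) * (B * w₊ - (θ - (K - B - C)) * w₀ + C * w₋)
    ≡⟨ regroup b B K C θ w₋ w₀ w₊ ⟩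
  scaled ((1ℚ - b) * B) ((1ℚ - b) * θ) ((1ℚ - b) * K) (b * (1ℚ - b) * C)
    ≡⟨ cong₂ (λ x y → scaled x y ((1ℚ - b) * K) (b * (1ℚ - b) * C)) (classical-bᵢ b d i) θ≡ ⟩
  scaled (D * D - p * p) (T - 1ℚ) ((1ℚ - b) * K) (b * (1ℚ - b) * C)
    ≡⟨ cong₂ (scaled (D * D - p * p) (T - 1ℚ)) (classical-bᵢ b d 0) (classical-cᵢ b d i) ⟩
  scaled (D * D - p * p) (T - 1ℚ) (D * D - 1ℚ * 1ℚ) (p * (1ℚ - p))
    ≡⟨ simplify b D p T w₋ w₀ w₊ ⟩
  defect b D p T w₋ w₀ w₊ ∎)
  where
  open ≡-Reasoning
  I : IntersectionNumbers
  I = classical b d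
  B K C D p : ℚ
  B = bᵢ I i
  K = valency I
  C = cᵢ I i
  D = b ^ d
  p = b ^ i
  scaled : (sB sθ sK bsC : ℚ) → ℚ
  scaled sB sθ sK bsC = b * sB * w₊ - (b * sθ - b * sK + b * sB + bsC) * w₀ + bsC * w₋
  regroup : ∀ b B K C θ w₋ w₀ w₊ →
    b * (1ℚ - b) * (B * w₊ - (θ - (K - B - C)) * w₀ + C * w₋) ≡
    b * ((1ℚ - b) * B) * w₊
      - (b * ((1ℚ - b) * θ) - b * ((1ℚ - b) * K) + b * ((1ℚ - b) * B) + b * (1ℚ - b) * C) * w₀
      + b * (1ℚ - b) * C * w₋
  regroup = solve-∀ ℚ-ring
  simplify : ∀ b D p T w₋ w₀ w₊ →
    b * (D * D - p * p) * w₊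
      - (b * (T - 1ℚ) - b * (D * D - 1ℚ * 1ℚ) + b * (D * D - p * p) + p * (1ℚ - p)) * w₀
      + p * (1ℚ - p) * w₋ ≡
    b * (D * D - p * p) * w₊ - (b * (T - 1ℚ) - (p - 1ℚ) * (b * p + b + p)) * w₀ + p * (1ℚ - p) * w₋
  simplify = solve-∀ ℚ-ring

defect-on-constant : ∀ b D p w₊ → defect b D p (D * D) 1ℚ 1ℚ w₊ ≡ b * (D * D - p * p) * (w₊ - 1ℚ)
defect-on-constant = certificate
  where
  certificate : ∀ b D p w₊ →
    b * (D * D - p * p) * w₊ - (b * (D * D - 1ℚ) - (p - 1ℚ) * (b * p + b + p)) * 1ℚ + p * (1ℚ - p) * 1ℚ
      ≡ b * (D * D - p * p) * (w₊ - 1ℚ)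
  certificate = solve-∀ ℚ-ring

-- The first n equations of the scaled recurrence; for diameter d the (d + 1)-st is the eigenvalue condition.
Recurrent : (b D T : ℚ) → ℕ → (ℕ → ℚ) → Set
Recurrent b D T n w = ∀ i → i ℕ.< n → defect b D (b ^ i) T (w (i ∸ 1)) (w i) (w (suc i)) ≡ 0ℚ

recurrent-extend : ∀ {b D T n w} → Recurrent b D T n w →
  defect b D (b ^ n) T (w (n ∸ 1)) (w n) (w (suc n)) ≡ 0ℚ → Recurrent b D T (suc n) w
recurrent-extend {n = n} rec last i i<1+n with ℕ.m≤n⇒m<n∨m≡n (ℕ.s≤s⁻¹ i<1+n)
... | inj₁ i<n = rec i i<n
... | inj₂ refl = last

contiguityDefect : (D p u y y₋ : ℚ) → ℚ
contiguityDefect D p u y y₋ = (D * D - 1ℚ) * p * u - (D * D - p * p) * y + p * (1ℚ - p) * y₋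

-- The certificates below restate defect and contiguityDefect inline: solve-∀ does not unfold definitions.
contiguity-base : ∀ b E T u₀ u₁ y₀ y₁ →
  b * contiguityDefect (b * E) (b * 1ℚ) u₁ y₁ y₀ ≡
  b * defect b (b * E) 1ℚ (b * T) u₀ u₀ u₁ - b * b * defect b E 1ℚ T y₀ y₀ y₁
  + b * b * (b * T - 1ℚ) * (u₀ - y₀)
contiguity-base = certificate
  where
  certificate : ∀ b E T u₀ u₁ y₀ y₁ →
    let D = b * E
        ρ = λ D p T w₋ w₀ w₊ →
              b * (D * D - p * p) * w₊ - (b * (T - 1ℚ) - (p - 1ℚ) * (b * p + b + p)) * w₀ + p * (1ℚ - p) * w₋
    in b * ((D * D - 1ℚ) * (b * 1ℚ) * u₁ - (D * D - b * 1ℚ * (b * 1ℚ)) * y₁ + b * 1ℚ * (1ℚ - b * 1ℚ) * y₀)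
       ≡
       b * ρ D 1ℚ (b * T) u₀ u₀ u₁ - b * b * ρ E 1ℚ T y₀ y₀ y₁
       + b * b * (b * T - 1ℚ) * (u₀ - y₀)
  certificate = solve-∀ ℚ-ring

contiguity-step : ∀ b E p T u₀ u₁ u₂ y₋ y₀ y₁ y₂ → let D = b * E ; P = b * p in
  b * (D * D - P * P) * contiguityDefect D (b * P) u₂ y₂ y₁ ≡
  (D * D - 1ℚ) * b * P * defect b D P (b * T) u₀ u₁ u₂
  + b * (b * (b * T - 1ℚ) - (P - 1ℚ) * (b * P + b + P)) * contiguityDefect D P u₁ y₁ y₀
  - b * b * P * (1ℚ - P) * contiguityDefect D p u₀ y₀ y₋
  - b * b * (D * D - P * P) * defect b E P T y₀ y₁ y₂
  + b * b * P * (1ℚ - P) * defect b E p T y₋ y₀ y₁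
contiguity-step = certificate
  where
  certificate : ∀ b E p T u₀ u₁ u₂ y₋ y₀ y₁ y₂ →
    let D = b * E
        P = b * p
        ρ = λ D p T w₋ w₀ w₊ →
              b * (D * D - p * p) * w₊ - (b * (T - 1ℚ) - (p - 1ℚ) * (b * p + b + p)) * w₀ + p * (1ℚ - p) * w₋
        Cl = λ p u y y₋ → (D * D - 1ℚ) * p * u - (D * D - p * p) * y + p * (1ℚ - p) * y₋
    in b * (D * D - P * P) * Cl (b * P) u₂ y₂ y₁ ≡
       (D * D - 1ℚ) * b * P * ρ D P (b * T) u₀ u₁ u₂
       + b * (b * (b * T - 1ℚ) - (P - 1ℚ) * (b * P + b + P)) * Cl P u₁ y₁ y₀
       - b * b * P * (1ℚ - P) * Cl p u₀ y₀ y₋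
       - b * b * (D * D - P * P) * ρ E P T y₀ y₁ y₂
       + b * b * P * (1ℚ - P) * ρ E p T y₋ y₀ y₁
  certificate = solve-∀ ℚ-ring

contiguity-propagates : ∀ b E p T u₀ u₁ u₂ y₋ y₀ y₁ y₂ → let D = b * E ; P = b * p in
  defect b D P (b * T) u₀ u₁ u₂ ≡ 0ℚ →
  contiguityDefect D P u₁ y₁ y₀ ≡ 0ℚ → contiguityDefect D p u₀ y₀ y₋ ≡ 0ℚ →
  defect b E P T y₀ y₁ y₂ ≡ 0ℚ → defect b E p T y₋ y₀ y₁ ≡ 0ℚ →
  b * (D * D - P * P) * contiguityDefect D (b * P) u₂ y₂ y₁ ≡ 0ℚ
contiguity-propagates b E p T u₀ u₁ u₂ y₋ y₀ y₁ y₂ ρU≡0 ctg₁≡0 ctg₀≡0 ρY₁≡0 ρY₀≡0 =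
  trans (contiguity-step b E p T u₀ u₁ u₂ y₋ y₀ y₁ y₂)
        (combination-vanishes ((D * D - 1ℚ) * b * P)
                              (b * (b * (b * T - 1ℚ) - (P - 1ℚ) * (b * P + b + P)))
                              (b * b * P * (1ℚ - P)) (b * b * (D * D - P * P)) (b * b * P * (1ℚ - P))
                              ρU≡0 ctg₁≡0 ctg₀≡0 ρY₁≡0 ρY₀≡0)
  where
  D P : ℚ
  D = b * E
  P = b * p
  combination-vanishes : ∀ {x₁ x₂ x₃ x₄ x₅} c₁ c₂ c₃ c₄ c₅ →
    x₁ ≡ 0ℚ → x₂ ≡ 0ℚ → x₃ ≡ 0ℚ → x₄ ≡ 0ℚ → x₅ ≡ 0ℚ → c₁ * x₁ + c₂ * x₂ - c₃ * x₃ - c₄ * x₄ + c₅ * x₅ ≡ 0ℚ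
  combination-vanishes c₁ c₂ c₃ c₄ c₅ refl refl refl refl refl = certificate c₁ c₂ c₃ c₄ c₅
    where
    certificate : ∀ c₁ c₂ c₃ c₄ c₅ → c₁ * 0ℚ + c₂ * 0ℚ - c₃ * 0ℚ - c₄ * 0ℚ + c₅ * 0ℚ ≡ 0ℚ
    certificate = solve-∀ ℚ-ring

last-equation : ∀ b E T u₀ u₁ u₂ y₋ y₀ y₁ y₂ → let D = b * E in
  contiguityDefect D D u₁ y₁ y₀ ≡ 0ℚ → contiguityDefect D E u₀ y₀ y₋ ≡ 0ℚ →
  defect b E E T y₋ y₀ y₁ ≡ 0ℚ →
  (D * D - 1ℚ) * b * D * defect b D D (b * T) u₀ u₁ u₂ ≡ 0ℚ
last-equation b E T u₀ u₁ u₂ y₋ y₀ y₁ y₂ ctg₁≡0 ctg₀≡0 ρY₀≡0 =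
  isolate (contiguityDefect D (b * D) u₂ y₂ y₁) ((D * D - 1ℚ) * b * D)
          (b * (b * (b * T - 1ℚ) - (D - 1ℚ) * (b * D + b + D)))
          (b * b * D * (1ℚ - D)) (b * b * D * (1ℚ - D))
          (defect b D D (b * T) u₀ u₁ u₂) (defect b E D T y₀ y₁ y₂)
          ctg₁≡0 ctg₀≡0 ρY₀≡0 (contiguity-step b E E T u₀ u₁ u₂ y₋ y₀ y₁ y₂)
  where
  D : ℚ
  D = b * E
  isolate : ∀ {x₂ x₃ x₅} z c₁ c₂ c₃ c₅ x₁ x₄ → x₂ ≡ 0ℚ → x₃ ≡ 0ℚ → x₅ ≡ 0ℚ →
    b * (D * D - D * D) * z ≡ c₁ * x₁ + c₂ * x₂ - c₃ * x₃ - b * b * (D * D - D * D) * x₄ + c₅ * x₅ →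
    c₁ * x₁ ≡ 0ℚ
  isolate z c₁ c₂ c₃ c₅ x₁ x₄ refl refl refl eq = begin
    c₁ * x₁
      ≡⟨ drop-zeros b D z c₁ c₂ c₃ c₅ x₁ x₄ ⟩
    (c₁ * x₁ + c₂ * 0ℚ - c₃ * 0ℚ - b * b * (D * D - D * D) * x₄ + c₅ * 0ℚ) - b * (D * D - D * D) * z
      ≡⟨ cong (_- b * (D * D - D * D) * z) eq ⟨
    b * (D * D - D * D) * z - b * (D * D - D * D) * z
      ≡⟨ +-inverseʳ (b * (D * D - D * D) * z) ⟩
    0ℚ ∎
    where
    open ≡-Reasoning
    drop-zeros : ∀ b D z c₁ c₂ c₃ c₅ x₁ x₄ →
      c₁ * x₁ ≡
      (c₁ * x₁ + c₂ * 0ℚ - c₃ * 0ℚ - b * b * (D * D - D * D) * x₄ + c₅ * 0ℚ) - b * (D * D - D * D) * z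
    drop-zeros = solve-∀ ℚ-ring

module _ {b : ℚ} (b≢0 : b ≢ 0ℚ) (b^≢1 : ∀ n → b ^ suc n ≢ 1ℚ) where

  b^≢0 : ∀ n → b ^ n ≢ 0ℚ
  b^≢0 zero = λ ()
  b^≢0 (suc n) = *-≢0 b≢0 (b^≢0 n)

  squares-differ : ∀ {i d} → i ℕ.< d → b ^ d * b ^ d - b ^ i * b ^ i ≢ 0ℚ
  squares-differ {i} {d} i<d = subst (λ d → b ^ d * b ^ d - b ^ i * b ^ i ≢ 0ℚ) d≡ (differ i (d ∸ suc i))
    where
    d≡ : i ℕ.+ suc (d ∸ suc i) ≡ d
    d≡ = trans (ℕ.+-suc i (d ∸ suc i)) (ℕ.m+[n∸m]≡n i<d)
    factor : ∀ p E → p * E * (p * E) - p * p ≡ p * p * (E * E - 1ℚ)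
    factor = solve-∀ ℚ-ring
    differ : ∀ i k → b ^ (i ℕ.+ suc k) * b ^ (i ℕ.+ suc k) - b ^ i * b ^ i ≢ 0ℚ
    differ i k D²-p²≡0 =
      b^≢1 (k ℕ.+ suc k) (trans (^-homo-* b (suc k) (suc k)) (x∙y⁻¹≈ε⇒x≈y (E * E) 1ℚ E²-1≡0))
      where
      p E : ℚ
      p = b ^ i
      E = b ^ suc k
      E²-1≡0 : E * E - 1ℚ ≡ 0ℚ
      E²-1≡0 = *-≡0-cancelˡ (*-≢0 (b^≢0 i) (b^≢0 i)) (begin
        p * p * (E * E - 1ℚ)                                 ≡⟨ factor p E ⟨
        p * E * (p * E) - p * p                              ≡⟨ cong (λ x → x * x - p * p) (^-homo-* b i (suc k)) ⟨
        b ^ (i ℕ.+ suc k) * b ^ (i ℕ.+ suc k) - p * p        ≡⟨ D²-p²≡0 ⟩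
        0ℚ                                                   ∎)
        where open ≡-Reasoning

  classical-bᵢ≢0 : ∀ {i d} → i ℕ.< d → bᵢ (classical b d) i ≢ 0ℚ
  classical-bᵢ≢0 {i} {d} i<d bᵢ≡0 =
    squares-differ i<d (trans (sym (classical-bᵢ b d i)) (trans (cong ((1ℚ - b) *_) bᵢ≡0) (*-zeroʳ (1ℚ - b))))

  cosine-recurrent : ∀ d {θ} T → (1ℚ - b) * θ ≡ T - 1ℚ →
    Recurrent b (b ^ d) T d (cosine (classical b d) θ)
  cosine-recurrent d {θ} T θ≡ i i<d = begin
    defect b (b ^ d) (b ^ i) T (w (i ∸ 1)) (w i) (w (suc i))
      ≡⟨ classical-defect b d i {θ} {T} θ≡ (w (i ∸ 1)) (w i) (w (suc i)) ⟩
    b * (1ℚ - b) * (bᵢ I i * w (suc i) - (θ - aᵢ I i) * w i + cᵢ I i * w (i ∸ 1))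
      ≡⟨ cong (b * (1ℚ - b) *_) (cosine-recurrence I θ i (classical-bᵢ≢0 i<d)) ⟩
    b * (1ℚ - b) * 0ℚ
      ≡⟨ *-zeroʳ (b * (1ℚ - b)) ⟩
    0ℚ ∎
    where
    open ≡-Reasoning
    I : IntersectionNumbers
    I = classical b d
    w : ℕ → ℚ
    w = cosine I θ

  cosine-top : ∀ d {θ} → (1ℚ - b) * θ ≡ b ^ d * b ^ d - 1ℚ →
    Recurrent b (b ^ d) (b ^ d * b ^ d) (suc d) (cosine (classical b d) θ) × cosine (classical b d) θ d ≡ 1ℚ
  cosine-top d {θ} θ≡ = recurrent-extend {b} {D} {D * D} {d} {w} rec last , w≡1
    where
    open ≡-Reasoning
    D : ℚ
    D = b ^ d
    w : ℕ → ℚ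
    w = cosine (classical b d) θ
    rec : Recurrent b D (D * D) d w
    rec = cosine-recurrent d (D * D) θ≡
    ones : ∀ i → i ℕ.≤ d → w (i ∸ 1) ≡ 1ℚ × w i ≡ 1ℚ
    ones zero _ = refl , refl
    ones (suc i) i<d with ones i (ℕ.<⇒≤ i<d)
    ... | w₋≡1 , w≡1 = w≡1 , x∙y⁻¹≈ε⇒x≈y (w (suc i)) 1ℚ
      (*-≡0-cancelˡ (*-≢0 b≢0 (squares-differ i<d)) (begin
        b * (D * D - b ^ i * b ^ i) * (w (suc i) - 1ℚ)
          ≡⟨ defect-on-constant b D (b ^ i) (w (suc i)) ⟨
        defect b D (b ^ i) (D * D) 1ℚ 1ℚ (w (suc i))
          ≡⟨ cong₂ (λ x y → defect b D (b ^ i) (D * D) x y (w (suc i))) w₋≡1 w≡1 ⟨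
        defect b D (b ^ i) (D * D) (w (i ∸ 1)) (w i) (w (suc i))
          ≡⟨ rec i i<d ⟩
        0ℚ ∎))
    w≡1 : w d ≡ 1ℚ
    w≡1 = proj₂ (ones d ℕ.≤-refl)
    last : defect b D D (D * D) (w (d ∸ 1)) (w d) (w (suc d)) ≡ 0ℚ
    last = begin
      defect b D D (D * D) (w (d ∸ 1)) (w d) (w (suc d))
        ≡⟨ cong₂ (λ x y → defect b D D (D * D) x y (w (suc d))) (proj₁ (ones d ℕ.≤-refl)) w≡1 ⟩
      defect b D D (D * D) 1ℚ 1ℚ (w (suc d))
        ≡⟨ defect-on-constant b D D (w (suc d)) ⟩
      b * (D * D - D * D) * (w (suc d) - 1ℚ)
        ≡⟨ vanish b D (w (suc d)) ⟩
      0ℚ ∎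
      where
      vanish : ∀ b D w₊ → b * (D * D - D * D) * (w₊ - 1ℚ) ≡ 0ℚ
      vanish = solve-∀ ℚ-ring

  contiguity : ∀ e {T U Y} → U 0 ≡ 1ℚ → Y 0 ≡ 1ℚ →
    Recurrent b (b ^ e) T (suc e) Y → Recurrent b (b ^ suc e) (b * T) (suc e) U →
    Recurrent b (b ^ suc e) (b * T) (suc (suc e)) U × (1ℚ + b ^ suc e) * U (suc e) ≡ Y e
  contiguity e {T} {U} {Y} U₀≡1 Y₀≡1 recY recU = recurrent-extend {b} {D} {b * T} {suc e} {U} recU last , last-cosines
    where
    E D : ℚ
    E = b ^ e
    D = b ^ suc e
    Contiguous : ℕ → Set
    Contiguous i = contiguityDefect D (b ^ i) (U i) (Y i) (Y (i ∸ 1)) ≡ 0ℚ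

    contiguous₀ : Contiguous 0
    contiguous₀ = trans (cong₂ (λ u y → contiguityDefect D 1ℚ u y y) U₀≡1 Y₀≡1) (certificate D)
      where
      certificate : ∀ D → (D * D - 1ℚ) * 1ℚ * 1ℚ - (D * D - 1ℚ * 1ℚ) * 1ℚ + 1ℚ * (1ℚ - 1ℚ) * 1ℚ ≡ 0ℚ
      certificate = solve-∀ ℚ-ring

    contiguous₁ : Contiguous 1
    contiguous₁ = *-≡0-cancelˡ b≢0 (begin
      b * contiguityDefect D (b * 1ℚ) (U 1) (Y 1) (Y 0)
        ≡⟨ contiguity-base b E T (U 0) (U 1) (Y 0) (Y 1) ⟩
      b * ρU - b * b * ρY + b * b * (b * T - 1ℚ) * (U 0 - Y 0)
        ≡⟨ cong₂ (λ x y → b * x - b * b * y + b * b * (b * T - 1ℚ) * (U 0 - Y 0))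
                 (recU 0 (ℕ.s≤s ℕ.z≤n)) (recY 0 (ℕ.s≤s ℕ.z≤n)) ⟩
      b * 0ℚ - b * b * 0ℚ + b * b * (b * T - 1ℚ) * (U 0 - Y 0)
        ≡⟨ cong₂ (λ u y → b * 0ℚ - b * b * 0ℚ + b * b * (b * T - 1ℚ) * (u - y)) U₀≡1 Y₀≡1 ⟩
      b * 0ℚ - b * b * 0ℚ + b * b * (b * T - 1ℚ) * (1ℚ - 1ℚ)
        ≡⟨ certificate b T ⟩
      0ℚ ∎)
      where
      open ≡-Reasoning
      ρU ρY : ℚ
      ρU = defect b D 1ℚ (b * T) (U 0) (U 0) (U 1)
      ρY = defect b E 1ℚ T (Y 0) (Y 0) (Y 1)
      certificate : ∀ b T → b * 0ℚ - b * b * 0ℚ + b * b * (b * T - 1ℚ) * (1ℚ - 1ℚ) ≡ 0ℚ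
      certificate = solve-∀ ℚ-ring

    contiguous-step : ∀ m → suc m ℕ.≤ e → Contiguous m → Contiguous (suc m) → Contiguous (suc (suc m))
    contiguous-step m m<e contiguousₘ contiguousₘ₊₁ = *-≡0-cancelˡ (*-≢0 b≢0 (squares-differ (ℕ.s≤s m<e)))
      (contiguity-propagates b E (b ^ m) T (U m) (U (suc m)) (U (suc (suc m)))
                             (Y (m ∸ 1)) (Y m) (Y (suc m)) (Y (suc (suc m)))
                             (recU (suc m) (ℕ.s≤s m<e)) contiguousₘ₊₁ contiguousₘ
                             (recY (suc m) (ℕ.s≤s m<e)) (recY m (ℕ.m≤n⇒m≤1+n m<e)))

    contiguous-upto : ∀ m → m ℕ.≤ e → Contiguous m × Contiguous (suc m)
    contiguous-upto zero _ = contiguous₀ , contiguous₁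
    contiguous-upto (suc m) m<e with contiguous-upto m (ℕ.<⇒≤ m<e)
    ... | contiguousₘ , contiguousₘ₊₁ = contiguousₘ₊₁ , contiguous-step m m<e contiguousₘ contiguousₘ₊₁

    last : defect b D D (b * T) (U e) (U (suc e)) (U (suc (suc e))) ≡ 0ℚ
    last = *-≡0-cancelˡ (*-≢0 (*-≢0 D²-1≢0 b≢0) (b^≢0 (suc e)))
      (last-equation b E T (U e) (U (suc e)) (U (suc (suc e))) (Y (e ∸ 1)) (Y e) (Y (suc e)) (Y (suc (suc e)))
                     (proj₂ (contiguous-upto e ℕ.≤-refl)) (proj₁ (contiguous-upto e ℕ.≤-refl)) (recY e ℕ.≤-refl))
      where
      D²-1≢0 : D * D - 1ℚ ≢ 0ℚ
      D²-1≢0 = subst (λ x → D * D - x ≢ 0ℚ) (*-identityˡ 1ℚ) (squares-differ {0} {suc e} (ℕ.s≤s ℕ.z≤n))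

    last-cosines : (1ℚ + D) * U (suc e) ≡ Y e
    last-cosines = x∙y⁻¹≈ε⇒x≈y ((1ℚ + D) * U (suc e)) (Y e) (*-≡0-cancelˡ (*-≢0 (b^≢0 (suc e)) D-1≢0) (begin
      D * (D - 1ℚ) * ((1ℚ + D) * U (suc e) - Y e)          ≡⟨ factor D (U (suc e)) (Y (suc e)) (Y e) ⟩
      contiguityDefect D D (U (suc e)) (Y (suc e)) (Y e)  ≡⟨ proj₂ (contiguous-upto e ℕ.≤-refl) ⟩
      0ℚ                                                  ∎))
      where
      open ≡-Reasoning
      D-1≢0 : D - 1ℚ ≢ 0ℚ
      D-1≢0 D-1≡0 = b^≢1 e (x∙y⁻¹≈ε⇒x≈y D 1ℚ D-1≡0)
      factor : ∀ D u y y₋ →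
        D * (D - 1ℚ) * ((1ℚ + D) * u - y₋) ≡ (D * D - 1ℚ) * D * u - (D * D - D * D) * y + D * (1ℚ - D) * y₋
      factor = solve-∀ ℚ-ring

ratio-identity : ∀ {R w p c β T D²} → R * (1ℚ - w) ≡ 1ℚ - p → (D² - 1ℚ) * w ≡ T - 1ℚ →
  c * (β - 1ℚ) ≡ β → D² ≡ T * β → β - 1ℚ ≢ 0ℚ → R * D² ≡ (D² - 1ℚ) * ((1ℚ - p) * c)
ratio-identity {R} {w} {p} {c} {β} {T} R[1-w]≡1-p D²-1*w≡T-1 c[β-1]≡β refl β-1≢0 =
  *-cancelʳ-≢0 (β - 1ℚ) β-1≢0 (begin
  R * (T * β) * (β - 1ℚ)
    ≡⟨ expand R w β T ⟩
  β * (T * β - 1ℚ) * (R * (1ℚ - w)) + β * R * ((T * β - 1ℚ) * w - (T - 1ℚ))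
    ≡⟨ cong₂ (λ x y → β * (T * β - 1ℚ) * x + β * R * (y - (T - 1ℚ))) R[1-w]≡1-p D²-1*w≡T-1 ⟩
  β * (T * β - 1ℚ) * (1ℚ - p) + β * R * ((T - 1ℚ) - (T - 1ℚ))
    ≡⟨ collect R p β T ⟩
  (T * β - 1ℚ) * (1ℚ - p) * β
    ≡⟨ cong ((T * β - 1ℚ) * (1ℚ - p) *_) c[β-1]≡β ⟨
  (T * β - 1ℚ) * (1ℚ - p) * (c * (β - 1ℚ))
    ≡⟨ reassociate (T * β - 1ℚ) (1ℚ - p) c (β - 1ℚ) ⟩
  (T * β - 1ℚ) * ((1ℚ - p) * c) * (β - 1ℚ) ∎)
  where
  open ≡-Reasoning
  expand : ∀ R w β T →
    R * (T * β) * (β - 1ℚ) ≡ β * (T * β - 1ℚ) * (R * (1ℚ - w)) + β * R * ((T * β - 1ℚ) * w - (T - 1ℚ))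
  expand = solve-∀ ℚ-ring
  collect : ∀ R p β T →
    β * (T * β - 1ℚ) * (1ℚ - p) + β * R * ((T - 1ℚ) - (T - 1ℚ)) ≡ (T * β - 1ℚ) * (1ℚ - p) * β
  collect = solve-∀ ℚ-ring
  reassociate : ∀ x y c z → x * y * (c * z) ≡ x * (y * c) * z
  reassociate = solve-∀ ℚ-ring

module Hermitian (q : ℕ) (2≤q : 2 ℕ.≤ q) where

  b Q : ℚ
  b = ι (ℤ.- (+ q))
  Q = ι (+ q)

  b≡-Q : b ≡ - Q
  b≡-Q = ι-neg (+ q)

  hermitian≡classical : ∀ d → hermitianIN q d ≡ classical b d
  hermitian≡classical d = cong₂ (classicalIN d b) (ι-- (ℤ.- (+ q)) ℤ.1ℤ)
    (trans (ι-- (ℤ.- ((ℤ.- (+ q)) ℤ.^ d)) ℤ.1ℤ)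
           (cong (_- 1ℚ) (trans (ι-neg ((ℤ.- (+ q)) ℤ.^ d)) (cong -_ (ι-^ (ℤ.- (+ q)) d)))))

  θ : ℕ → ℕ → ℚ
  θ = hermitianEigenvalue q

  θ-scaled : ∀ d j → (1ℚ - b) * θ d j ≡ b ^ (2 ℕ.* d ∸ j) - 1ℚ
  θ-scaled d j = begin
    (1ℚ - b) * θ d j                     ≡⟨ cong (_* θ d j) 1-b≡ ⟩
    ι (+ suc q) * θ d j                  ≡⟨ *-comm (ι (+ suc q)) (θ d j) ⟩
    θ d j * ι (+ suc q)                  ≡⟨ /-*-denominator ((ℤ.- (+ q)) ℤ.^ n ℤ.- ℤ.1ℤ) q ⟩
    ι ((ℤ.- (+ q)) ℤ.^ n ℤ.- ℤ.1ℤ)       ≡⟨ ι-- ((ℤ.- (+ q)) ℤ.^ n) ℤ.1ℤ ⟩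
    ι ((ℤ.- (+ q)) ℤ.^ n) - 1ℚ           ≡⟨ cong (_- 1ℚ) (ι-^ (ℤ.- (+ q)) n) ⟩
    b ^ n - 1ℚ                           ∎
    where
    open ≡-Reasoning
    n : ℕ
    n = 2 ℕ.* d ∸ j
    1-b≡ : 1ℚ - b ≡ ι (+ suc q)
    1-b≡ = trans (cong (λ x → 1ℚ - x) b≡-Q) (trans (double-negation Q) (sym (ι-+ (+ 1) (+ q))))
      where
      double-negation : ∀ x → 1ℚ - - x ≡ 1ℚ + x
      double-negation = solve-∀ ℚ-ring

  2≤Q : 1ℚ + 1ℚ ≤ Q
  2≤Q = ι-mono 2≤q

  1≤Q : 1ℚ ≤ Q
  1≤Q = ≤-trans (ι-mono {1} {2} (ℕ.s≤s ℕ.z≤n)) 2≤Q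

  1≤Q^ : ∀ n → 1ℚ ≤ Q ^ n
  1≤Q^ zero = ≤-refl
  1≤Q^ (suc n) = ≤-trans 1≤Q (≤-trans (≤-reflexive (sym (*-identityʳ Q)))
    (*-monoˡ-≤-nonNeg Q {{nonNegative (≤-trans (nonNegative⁻¹ 1ℚ) 1≤Q)}} (1≤Q^ n)))

  0≤Q^ : ∀ n → 0ℚ ≤ Q ^ n
  0≤Q^ n = ≤-trans (nonNegative⁻¹ 1ℚ) (1≤Q^ n)

  Q^-mono : ∀ {m n} → m ℕ.≤ n → Q ^ m ≤ Q ^ n
  Q^-mono {m} {n} m≤n = begin
    Q ^ m                    ≡⟨ *-identityʳ (Q ^ m) ⟨
    Q ^ m * 1ℚ               ≤⟨ *-monoˡ-≤-nonNeg (Q ^ m) {{nonNegative (0≤Q^ m)}} (1≤Q^ (n ∸ m)) ⟩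
    Q ^ m * Q ^ (n ∸ m)      ≡⟨ ^-homo-* Q m (n ∸ m) ⟨
    Q ^ (m ℕ.+ (n ∸ m))      ≡⟨ cong (Q ^_) (ℕ.m+[n∸m]≡n m≤n) ⟩
    Q ^ n                    ∎
    where open ≤-Reasoning

  2≤Q^ : ∀ n → 1ℚ + 1ℚ ≤ Q ^ suc n
  2≤Q^ n = ≤-trans 2≤Q (≤-trans (≤-reflexive (sym (*-identityʳ Q))) (Q^-mono {1} {suc n} (ℕ.s≤s ℕ.z≤n)))

  b^≡±Q^ : ∀ n → b ^ n ≡ Q ^ n ⊎ b ^ n ≡ - (Q ^ n)
  b^≡±Q^ zero = inj₁ refl
  b^≡±Q^ (suc n) with b^≡±Q^ n
  ... | inj₁ b^≡Q^ = inj₂ (trans (cong₂ _*_ b≡-Q b^≡Q^) (sym (neg-distribˡ-* Q (Q ^ n))))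
  ... | inj₂ b^≡-Q^ = inj₁ (trans (cong₂ _*_ b≡-Q b^≡-Q^) (negated-product Q (Q ^ n)))
    where
    negated-product : ∀ x y → - x * - y ≡ x * y
    negated-product = solve-∀ ℚ-ring

  b≢0 : b ≢ 0ℚ
  b≢0 b≡0 = contradiction (≤-trans 1≤Q (≤-reflexive Q≡-0)) λ { (*≤* (ℤ.+≤+ ())) }
    where
    Q≡-0 : Q ≡ - 0ℚ
    Q≡-0 = trans (sym (⁻¹-involutive Q)) (cong -_ (trans (sym b≡-Q) b≡0))

  b^≢1 : ∀ n → b ^ suc n ≢ 1ℚ
  b^≢1 n b^≡1 with b^≡±Q^ (suc n)
  ... | inj₁ b^≡Q^ = contradiction (≤-trans (2≤Q^ n) (≤-reflexive (trans (sym b^≡Q^) b^≡1)))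
    λ { (*≤* (ℤ.+≤+ (ℕ.s≤s ()))) }
  ... | inj₂ b^≡-Q^ = contradiction (≤-trans (2≤Q^ n) (≤-reflexive Q^≡-1)) λ { (*≤* ()) }
    where
    Q^≡-1 : Q ^ suc n ≡ - 1ℚ
    Q^≡-1 = trans (sym (⁻¹-involutive (Q ^ suc n))) (cong -_ (trans (sym b^≡-Q^) b^≡1))

  w : ℕ → ℕ → ℕ → ℚ
  w d j = cosine (classical b d) (θ d j)

  P : ℕ → ℕ → ℚ
  P d j = w d j d

  T : ℕ → ℕ → ℚ
  T d j = b ^ (2 ℕ.* d ∸ j)

  T-top : ∀ d → T d 0 ≡ b ^ d * b ^ d
  T-top d = trans (cong (λ n → b ^ (d ℕ.+ n)) (ℕ.+-identityʳ d)) (^-homo-* b d d)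

  T-shift : ∀ {e j} → j ℕ.≤ e → T (suc e) (suc j) ≡ b * T e j
  T-shift {e} {j} j≤e =
    cong (b ^_) (trans (cong (_∸ suc j) (ℕ.*-suc 2 e)) (ℕ.+-∸-assoc 1 (ℕ.≤-trans j≤e (ℕ.m≤n*m e 2))))

  θ-top-scaled : ∀ d → (1ℚ - b) * θ d 0 ≡ b ^ d * b ^ d - 1ℚ
  θ-top-scaled d = trans (θ-scaled d 0) (cong (_- 1ℚ) (T-top d))

  θ-recurrent : ∀ d j → j ℕ.≤ d → Recurrent b (b ^ d) (T d j) (suc d) (w d j)
  θ-contiguity : ∀ e j → j ℕ.≤ e →
    Recurrent b (b ^ suc e) (T (suc e) (suc j)) (suc (suc e)) (w (suc e) (suc j)) ×
    (1ℚ + b ^ suc e) * P (suc e) (suc j) ≡ P e j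

  θ-recurrent d zero _ = subst (λ t → Recurrent b (b ^ d) t (suc d) (w d 0)) (sym (T-top d))
    (proj₁ (cosine-top b≢0 b^≢1 d (θ-top-scaled d)))
  θ-recurrent (suc e) (suc j) (ℕ.s≤s j≤e) = proj₁ (θ-contiguity e j j≤e)

  θ-contiguity e j j≤e =
    subst (λ t → Recurrent b (b ^ suc e) t (suc (suc e)) (w (suc e) (suc j))) (sym (T-shift j≤e))
          (proj₁ contiguous)
    , proj₂ contiguous
    where
    contiguous : Recurrent b (b ^ suc e) (b * T e j) (suc (suc e)) (w (suc e) (suc j)) ×
                 (1ℚ + b ^ suc e) * P (suc e) (suc j) ≡ P e j
    contiguous = contiguity b≢0 b^≢1 e {T e j} refl refl (θ-recurrent e j j≤e)
      (cosine-recurrent b≢0 b^≢1 (suc e) (b * T e j) (trans (θ-scaled (suc e) (suc j)) (cong (_- 1ℚ) (T-shift j≤e))))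

  P-top : ∀ d → P d 0 ≡ 1ℚ
  P-top d = proj₂ (cosine-top b≢0 b^≢1 d (θ-top-scaled d))

  P-shift : ∀ {e j} → j ℕ.≤ e → (1ℚ + b ^ suc e) * P (suc e) (suc j) ≡ P e j
  P-shift {e} {j} j≤e = proj₂ (θ-contiguity e j j≤e)

  Q^-1≤∣1+b^∣ : ∀ k → Q ^ k - 1ℚ ≤ ∣ 1ℚ + b ^ k ∣
  Q^-1≤∣1+b^∣ k with b^≡±Q^ k
  ... | inj₁ b^≡Q^ = begin
    Q ^ k - 1ℚ          ≤⟨ ≤-from-difference (gap (Q ^ k)) (nonNegative⁻¹ (1ℚ + 1ℚ)) ⟩
    1ℚ + Q ^ k          ≡⟨ 0≤p⇒∣p∣≡p (+-mono-≤ (nonNegative⁻¹ 1ℚ) (0≤Q^ k)) ⟨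
    ∣ 1ℚ + Q ^ k ∣      ≡⟨ cong (λ x → ∣ 1ℚ + x ∣) b^≡Q^ ⟨
    ∣ 1ℚ + b ^ k ∣      ∎
    where
    open ≤-Reasoning
    gap : ∀ x → 1ℚ + x - (x - 1ℚ) ≡ 1ℚ + 1ℚ
    gap = solve-∀ ℚ-ring
  ... | inj₂ b^≡-Q^ = ≤-reflexive (sym (begin
    ∣ 1ℚ + b ^ k ∣          ≡⟨ cong (λ x → ∣ 1ℚ + x ∣) b^≡-Q^ ⟩
    ∣ 1ℚ + - (Q ^ k) ∣      ≡⟨ cong ∣_∣ (swap (Q ^ k)) ⟩
    ∣ - (Q ^ k - 1ℚ) ∣      ≡⟨ ∣-p∣≡∣p∣ (Q ^ k - 1ℚ) ⟩
    ∣ Q ^ k - 1ℚ ∣          ≡⟨ 0≤p⇒∣p∣≡p (difference-nonNeg (1≤Q^ k)) ⟩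
    Q ^ k - 1ℚ              ∎))
    where
    open ≡-Reasoning
    swap : ∀ x → 1ℚ + - x ≡ - (x - 1ℚ)
    swap = solve-∀ ℚ-ring

  ∣P∣-shift : ∀ {e j} → j ℕ.≤ e → (Q ^ suc e - 1ℚ) * ∣ P (suc e) (suc j) ∣ ≤ ∣ P e j ∣
  ∣P∣-shift {e} {j} j≤e = begin
    (Q ^ suc e - 1ℚ) * ∣ p ∣        ≤⟨ *-monoʳ-≤-nonNeg ∣ p ∣ {{nonNegative (0≤∣p∣ p)}} (Q^-1≤∣1+b^∣ (suc e)) ⟩
    ∣ 1ℚ + b ^ suc e ∣ * ∣ p ∣      ≡⟨ ∣p*q∣≡∣p∣*∣q∣ (1ℚ + b ^ suc e) p ⟨
    ∣ (1ℚ + b ^ suc e) * p ∣        ≡⟨ cong ∣_∣ (P-shift j≤e) ⟩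
    ∣ P e j ∣                      ∎
    where
    open ≤-Reasoning
    p : ℚ
    p = P (suc e) (suc j)

  1≤Q^-1 : ∀ n → 1ℚ ≤ Q ^ suc n - 1ℚ
  1≤Q^-1 n = ≤-from-difference (shift (Q ^ suc n)) (difference-nonNeg (2≤Q^ n))
    where
    shift : ∀ x → x - 1ℚ - 1ℚ ≡ x - (1ℚ + 1ℚ)
    shift = solve-∀ ℚ-ring

  ∣P∣≤1 : ∀ d j → j ℕ.≤ d → ∣ P d j ∣ ≤ 1ℚ
  ∣P∣≤1 d zero _ = ≤-reflexive (cong ∣_∣ (P-top d))
  ∣P∣≤1 (suc e) (suc j) (ℕ.s≤s j≤e) = begin
    ∣ p ∣                        ≡⟨ *-identityˡ ∣ p ∣ ⟨
    1ℚ * ∣ p ∣                   ≤⟨ *-monoʳ-≤-nonNeg ∣ p ∣ {{nonNegative (0≤∣p∣ p)}} (1≤Q^-1 e) ⟩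
    (Q ^ suc e - 1ℚ) * ∣ p ∣     ≤⟨ ∣P∣-shift j≤e ⟩
    ∣ P e j ∣                   ≤⟨ ∣P∣≤1 e j j≤e ⟩
    1ℚ                          ∎
    where
    open ≤-Reasoning
    p : ℚ
    p = P (suc e) (suc j)

  ∣P∣-bound₁ : ∀ {e j} → j ℕ.≤ e → (Q ^ suc e - 1ℚ) * ∣ P (suc e) (suc j) ∣ ≤ 1ℚ
  ∣P∣-bound₁ {e} {j} j≤e = ≤-trans (∣P∣-shift j≤e) (∣P∣≤1 e j j≤e)

  ∣P∣-bound₂ : ∀ {e j} → j ℕ.≤ e →
    (Q ^ suc (suc e) - 1ℚ) * (Q ^ suc e - 1ℚ) * ∣ P (suc (suc e)) (suc (suc j)) ∣ ≤ 1ℚ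
  ∣P∣-bound₂ {e} {j} j≤e = begin
    (Q ^ suc (suc e) - 1ℚ) * (Q ^ suc e - 1ℚ) * ∣ P (suc (suc e)) (suc (suc j)) ∣
      ≡⟨ reassociate (Q ^ suc (suc e) - 1ℚ) (Q ^ suc e - 1ℚ) ∣ P (suc (suc e)) (suc (suc j)) ∣ ⟩
    (Q ^ suc e - 1ℚ) * ((Q ^ suc (suc e) - 1ℚ) * ∣ P (suc (suc e)) (suc (suc j)) ∣)
      ≤⟨ *-monoˡ-≤-nonNeg (Q ^ suc e - 1ℚ) {{nonNegative (≤-trans (nonNegative⁻¹ 1ℚ) (1≤Q^-1 e))}}
                          (∣P∣-shift (ℕ.s≤s j≤e)) ⟩
    (Q ^ suc e - 1ℚ) * ∣ P (suc e) (suc j) ∣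
      ≤⟨ ∣P∣-bound₁ j≤e ⟩
    1ℚ ∎
    where
    open ≤-Reasoning
    reassociate : ∀ x y z → x * y * z ≡ y * (x * z)
    reassociate = solve-∀ ℚ-ring

  P₂≤0 : ∀ e → P (suc (suc e)) 2 ≤ 0ℚ
  P₂≤0 e with ≤-total (P (suc (suc e)) 2) 0ℚ
  ... | inj₁ P₂≤0 = P₂≤0
  ... | inj₂ 0≤P₂ = contradiction (≤-trans (*-nonNeg 0≤P₂ 0≤-N) (≤-reflexive P₂*-N≡-1)) λ { (*≤* ()) }
    where
    x X N : ℚ
    x = b ^ suc e
    X = Q ^ suc e
    N = (1ℚ + b * x) * (1ℚ + x)
    0≤X : 0ℚ ≤ X
    0≤X = 0≤Q^ (suc e)
    1≤X : 1ℚ ≤ X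
    1≤X = 1≤Q^ (suc e)
    P₂*N≡1 : P (suc (suc e)) 2 * N ≡ 1ℚ
    P₂*N≡1 = begin
      P (suc (suc e)) 2 * N                           ≡⟨ reorder (P (suc (suc e)) 2) (1ℚ + b * x) (1ℚ + x) ⟩
      (1ℚ + x) * ((1ℚ + b * x) * P (suc (suc e)) 2)   ≡⟨ cong ((1ℚ + x) *_) (P-shift {suc e} {1} (ℕ.s≤s ℕ.z≤n)) ⟩
      (1ℚ + x) * P (suc e) 1                          ≡⟨ P-shift {e} {0} ℕ.z≤n ⟩
      P e 0                                           ≡⟨ P-top e ⟩
      1ℚ                                              ∎
      where
      open ≡-Reasoning
      reorder : ∀ p u v → p * (u * v) ≡ v * (u * p)
      reorder = solve-∀ ℚ-ring
    P₂*-N≡-1 : P (suc (suc e)) 2 * - N ≡ - 1ℚ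
    P₂*-N≡-1 = trans (sym (neg-distribʳ-* (P (suc (suc e)) 2) N)) (cong -_ P₂*N≡1)
    0≤-N : 0ℚ ≤ - N
    0≤-N with b^≡±Q^ (suc e)
    ... | inj₁ x≡X = begin
      0ℚ                                    ≤⟨ *-nonNeg (+-mono-≤ (*-nonNeg (difference-nonNeg 1≤Q) 0≤X) (difference-nonNeg 1≤X))
                                                        (+-mono-≤ (nonNegative⁻¹ 1ℚ) 0≤X) ⟩
      ((Q - 1ℚ) * X + (X - 1ℚ)) * (1ℚ + X)  ≡⟨ expand Q X ⟩
      - ((1ℚ + - Q * X) * (1ℚ + X))         ≡⟨ cong₂ (λ u v → - ((1ℚ + u * v) * (1ℚ + v))) b≡-Q x≡X ⟨
      - N                                   ∎
      where
      open ≤-Reasoning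
      expand : ∀ Q X → ((Q - 1ℚ) * X + (X - 1ℚ)) * (1ℚ + X) ≡ - ((1ℚ + - Q * X) * (1ℚ + X))
      expand = solve-∀ ℚ-ring
    ... | inj₂ x≡-X = begin
      0ℚ                                    ≤⟨ *-nonNeg (+-mono-≤ (nonNegative⁻¹ 1ℚ) (*-nonNeg (0≤Q^ 1) 0≤X)) (difference-nonNeg 1≤X) ⟩
      (1ℚ + Q ^ 1 * X) * (X - 1ℚ)           ≡⟨ expand Q X ⟩
      - ((1ℚ + - Q * - X) * (1ℚ + - X))     ≡⟨ cong₂ (λ u v → - ((1ℚ + u * v) * (1ℚ + v))) b≡-Q x≡-X ⟨
      - N                                   ∎
      where
      open ≤-Reasoning
      expand : ∀ Q X → (1ℚ + Q * 1ℚ * X) * (X - 1ℚ) ≡ - ((1ℚ + - Q * - X) * (1ℚ + - X))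
      expand = solve-∀ ℚ-ring

  c : ℕ → ℚ
  c j = safeDiv (b ^ j) (b ^ j - 1ℚ)

  b^-1≢0 : ∀ n → b ^ suc n - 1ℚ ≢ 0ℚ
  b^-1≢0 n b^-1≡0 = b^≢1 n (x∙y⁻¹≈ε⇒x≈y (b ^ suc n) 1ℚ b^-1≡0)

  c-spec : ∀ j → c (suc j) * (b ^ suc j - 1ℚ) ≡ b ^ suc j
  c-spec j = safeDiv-* (b ^ suc j) (b^-1≢0 j)

  v : ℕ → ℕ → ℚ
  v d j = (1ℚ - P d j) * c j

  first-cosine : ∀ {d j} → j ℕ.≤ d → (b ^ d * b ^ d - 1ℚ) * w d j 1 ≡ T d j - 1ℚ
  first-cosine {d} {j} j≤d = x∙y⁻¹≈ε⇒x≈y _ (T d j - 1ℚ) (*-≡0-cancelˡ b≢0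
    (trans (sym (factor b (b ^ d) (T d j) (w d j 1))) (θ-recurrent d j j≤d 0 (ℕ.s≤s ℕ.z≤n))))
    where
    factor : ∀ b D T w₁ → defect b D 1ℚ T 1ℚ 1ℚ w₁ ≡ b * ((D * D - 1ℚ) * w₁ - (T - 1ℚ))
    factor = certificate
      where
      certificate : ∀ b D T w₁ →
        b * (D * D - 1ℚ * 1ℚ) * w₁ - (b * (T - 1ℚ) - (1ℚ - 1ℚ) * (b * 1ℚ + b + 1ℚ)) * 1ℚ + 1ℚ * (1ℚ - 1ℚ) * 1ℚ
          ≡ b * ((D * D - 1ℚ) * w₁ - (T - 1ℚ))
      certificate = solve-∀ ℚ-ring

  b^d*b^d≡T*b^j : ∀ {d j} → j ℕ.≤ d → b ^ d * b ^ d ≡ T d j * b ^ j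
  b^d*b^d≡T*b^j {d} {j} j≤d = begin
    b ^ d * b ^ d                 ≡⟨ T-top d ⟨
    b ^ (2 ℕ.* d)                 ≡⟨ cong (b ^_) (ℕ.m∸n+n≡m (ℕ.≤-trans j≤d (ℕ.m≤n*m d 2))) ⟨
    b ^ ((2 ℕ.* d ∸ j) ℕ.+ j)     ≡⟨ ^-homo-* b (2 ℕ.* d ∸ j) j ⟩
    T d j * b ^ j                 ∎
    where open ≡-Reasoning

  ratio-scaled : ∀ {d j} → suc j ℕ.≤ d →
    ratio q d (suc j) * (b ^ d * b ^ d) ≡ (b ^ d * b ^ d - 1ℚ) * v d (suc j)
  ratio-scaled {d} {j} j<d =
    ratio-identity {ratio q d (suc j)} {w₁} {P d (suc j)} {c (suc j)} {β} {t} {D²}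
                   R[1-w₁]≡1-P (first-cosine j<d) (c-spec j) (b^d*b^d≡T*b^j j<d) (b^-1≢0 j)
    where
    D² t β w₁ : ℚ
    D² = b ^ d * b ^ d
    t = T d (suc j)
    β = b ^ suc j
    w₁ = w d (suc j) 1
    1-w₁≢0 : 1ℚ - w₁ ≢ 0ℚ
    1-w₁≢0 1-w₁≡0 = *-≢0 (b^≢0 b≢0 b^≢1 (2 ℕ.* d ∸ suc j)) (b^-1≢0 j) (begin
      t * (β - 1ℚ)                      ≡⟨ expand t β ⟩
      t * β - 1ℚ - (t - 1ℚ)             ≡⟨ cong₂ (λ x y → x - 1ℚ - y) (b^d*b^d≡T*b^j j<d) (first-cosine j<d) ⟨
      D² - 1ℚ - (D² - 1ℚ) * w₁          ≡⟨ cong (λ x → D² - 1ℚ - (D² - 1ℚ) * x) w₁≡1 ⟨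
      D² - 1ℚ - (D² - 1ℚ) * 1ℚ          ≡⟨ cancel D² ⟩
      0ℚ                                ∎)
      where
      open ≡-Reasoning
      w₁≡1 : 1ℚ ≡ w₁
      w₁≡1 = x∙y⁻¹≈ε⇒x≈y 1ℚ w₁ 1-w₁≡0
      expand : ∀ t β → t * (β - 1ℚ) ≡ t * β - 1ℚ - (t - 1ℚ)
      expand = solve-∀ ℚ-ring
      cancel : ∀ x → x - 1ℚ - (x - 1ℚ) * 1ℚ ≡ 0ℚ
      cancel = solve-∀ ℚ-ring
    R[1-w₁]≡1-P : ratio q d (suc j) * (1ℚ - w₁) ≡ 1ℚ - P d (suc j)
    R[1-w₁]≡1-P =
      trans (cong (λ I → safeDiv (1ℚ - cosine I (θ d (suc j)) d) (1ℚ - cosine I (θ d (suc j)) 1) * (1ℚ - w₁))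
                  (hermitian≡classical d))
            (safeDiv-* (1ℚ - P d (suc j)) 1-w₁≢0)

  b²≡Q² : b ^ 2 ≡ Q ^ 2
  b²≡Q² = trans (cong (λ x → x * (x * 1ℚ)) b≡-Q) (square-of-negation Q)
    where
    square-of-negation : ∀ x → - x * (- x * 1ℚ) ≡ x * (x * 1ℚ)
    square-of-negation = solve-∀ ℚ-ring

  c₂-spec : c 2 * (Q ^ 2 - 1ℚ) ≡ Q ^ 2
  c₂-spec = subst (λ x → c 2 * (x - 1ℚ) ≡ x) b²≡Q² (c-spec 1)

  0<Q²-1 : 0ℚ < Q ^ 2 - 1ℚ
  0<Q²-1 = 0<-from-1≤ (1≤Q^-1 1)

  0≤c₂ : 0ℚ ≤ c 2
  0≤c₂ = ≤-by-positive-factor 0<Q²-1 (begin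
    0ℚ * (Q ^ 2 - 1ℚ)   ≡⟨ *-zeroˡ (Q ^ 2 - 1ℚ) ⟩
    0ℚ                  ≤⟨ 0≤Q^ 2 ⟩
    Q ^ 2               ≡⟨ c₂-spec ⟨
    c 2 * (Q ^ 2 - 1ℚ)  ∎)
    where open ≤-Reasoning

  c₂≤v₂ : ∀ e → c 2 ≤ v (suc (suc e)) 2
  c₂≤v₂ e = ≤-from-difference (shift (P (suc (suc e)) 2) (c 2)) (*-nonNeg (difference-nonNeg (P₂≤0 e)) 0≤c₂)
    where
    shift : ∀ p c → (1ℚ - p) * c - c ≡ (0ℚ - p) * c
    shift = solve-∀ ℚ-ring

  v≤c₂-odd : ∀ {e j} → j ℕ.≤ e → 1 ℕ.≤ e → b ^ suc j ≡ - (Q ^ suc j) → v (suc e) (suc j) ≤ c 2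
  v≤c₂-odd {e} {j} j≤e 1≤e b^≡-X = ≤-by-positive-factor 0<den (≤-from-difference gap≡ 0≤gap)
    where
    X Q₂ Qd p E cⱼ den : ℚ
    X = Q ^ suc j
    Q₂ = Q ^ 2
    Qd = Q ^ suc e
    p = P (suc e) (suc j)
    E = ∣ p ∣
    cⱼ = c (suc j)
    den = (X + 1ℚ) * (Q₂ - 1ℚ)
    0<den : 0ℚ < den
    0<den = *-pos (0<-from-1≤ (≤-from-difference {1ℚ} {X + 1ℚ} (gap X) (0≤Q^ (suc j)))) 0<Q²-1
      where
      gap : ∀ x → x + 1ℚ - 1ℚ ≡ x
      gap = solve-∀ ℚ-ring
    cⱼ[X+1]≡X : cⱼ * (X + 1ℚ) ≡ X
    cⱼ[X+1]≡X = begin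
      cⱼ * (X + 1ℚ)                  ≡⟨ negate cⱼ X ⟩
      - (cⱼ * (- X - 1ℚ))            ≡⟨ cong (λ y → - (cⱼ * (y - 1ℚ))) b^≡-X ⟨
      - (cⱼ * (b ^ suc j - 1ℚ))      ≡⟨ cong -_ (trans (c-spec j) b^≡-X) ⟩
      - - X                          ≡⟨ ⁻¹-involutive X ⟩
      X                              ∎
      where
      open ≡-Reasoning
      negate : ∀ c x → c * (x + 1ℚ) ≡ - (c * (- x - 1ℚ))
      negate = solve-∀ ℚ-ring
    gap≡ : c 2 * den - v (suc e) (suc j) * den ≡ Q₂ + X * ((1ℚ - (Qd - 1ℚ) * E) + (Qd - Q₂) * E + (Q₂ - 1ℚ) * (p + E))
    gap≡ = begin
      c 2 * den - (1ℚ - p) * cⱼ * den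
        ≡⟨ regroup (c 2) cⱼ p X Q₂ ⟩
      (X + 1ℚ) * (c 2 * (Q₂ - 1ℚ)) - (1ℚ - p) * (cⱼ * (X + 1ℚ)) * (Q₂ - 1ℚ)
        ≡⟨ cong₂ (λ x y → (X + 1ℚ) * x - (1ℚ - p) * y * (Q₂ - 1ℚ)) c₂-spec cⱼ[X+1]≡X ⟩
      (X + 1ℚ) * Q₂ - (1ℚ - p) * X * (Q₂ - 1ℚ)
        ≡⟨ certificate X Q₂ Qd p E ⟩
      Q₂ + X * ((1ℚ - (Qd - 1ℚ) * E) + (Qd - Q₂) * E + (Q₂ - 1ℚ) * (p + E)) ∎
      where
      open ≡-Reasoning
      regroup : ∀ c₂ c p X Q₂ → c₂ * ((X + 1ℚ) * (Q₂ - 1ℚ)) - (1ℚ - p) * c * ((X + 1ℚ) * (Q₂ - 1ℚ))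
        ≡ (X + 1ℚ) * (c₂ * (Q₂ - 1ℚ)) - (1ℚ - p) * (c * (X + 1ℚ)) * (Q₂ - 1ℚ)
      regroup = solve-∀ ℚ-ring
      certificate : ∀ X Q₂ Qd p E → (X + 1ℚ) * Q₂ - (1ℚ - p) * X * (Q₂ - 1ℚ)
        ≡ Q₂ + X * ((1ℚ - (Qd - 1ℚ) * E) + (Qd - Q₂) * E + (Q₂ - 1ℚ) * (p + E))
      certificate = solve-∀ ℚ-ring
    0≤gap : 0ℚ ≤ Q₂ + X * ((1ℚ - (Qd - 1ℚ) * E) + (Qd - Q₂) * E + (Q₂ - 1ℚ) * (p + E))
    0≤gap = +-mono-≤ (0≤Q^ 2) (*-nonNeg (0≤Q^ (suc j))
      (+-mono-≤ (+-mono-≤ (difference-nonNeg (∣P∣-bound₁ j≤e))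
                          (*-nonNeg (difference-nonNeg (Q^-mono (ℕ.s≤s 1≤e))) (0≤∣p∣ p)))
                (*-nonNeg (difference-nonNeg (1≤Q^ 2)) (0≤p+∣p∣ p))))

  Q⁴≤Q^ : ∀ {n} → 4 ℕ.≤ n → Q ^ 2 * Q ^ 2 ≤ Q ^ n
  Q⁴≤Q^ 4≤n = ≤-trans (≤-reflexive (sym (^-homo-* Q 2 2))) (Q^-mono 4≤n)

  v≤c₂-even : ∀ {e j} → j ℕ.≤ e → 2 ℕ.≤ j → b ^ suc (suc j) ≡ Q ^ suc (suc j) →
    v (suc (suc e)) (suc (suc j)) ≤ c 2
  v≤c₂-even {e} {j} j≤e 2≤j b^≡X = ≤-by-positive-factor 0<den (≤-from-difference refl 0≤Z)
    where
    X Q₂ Qd Qe p E cⱼ den Z C : ℚ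
    X = Q ^ suc (suc j)
    Q₂ = Q ^ 2
    Qd = Q ^ suc (suc e)
    Qe = Q ^ suc e
    p = P (suc (suc e)) (suc (suc j))
    E = ∣ p ∣
    cⱼ = c (suc (suc j))
    den = (X - 1ℚ) * (Q₂ - 1ℚ)
    0<den : 0ℚ < den
    0<den = *-pos (0<-from-1≤ (1≤Q^-1 (suc j))) 0<Q²-1
    cⱼ[X-1]≡X : cⱼ * (X - 1ℚ) ≡ X
    cⱼ[X-1]≡X = subst (λ x → cⱼ * (x - 1ℚ) ≡ x) b^≡X (c-spec (suc j))
    Z = c 2 * den - v (suc (suc e)) (suc (suc j)) * den
    C = X * (Q₂ - 1ℚ) * ((1ℚ - (Qd - 1ℚ) * (Qe - 1ℚ) * E)
                         + ((Qd - 1ℚ - Q₂) * (Qe - 1ℚ) + Q₂ * (Qe - (1ℚ + 1ℚ))) * E)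
        + (X - Q₂ * Q₂) + Q₂ * X * (Q₂ - 1ℚ) * (p + E)
    Z*Q₂≡C : Z * Q₂ ≡ C
    Z*Q₂≡C = begin
      (c 2 * den - (1ℚ - p) * cⱼ * den) * Q₂
        ≡⟨ regroup (c 2) cⱼ p X Q₂ ⟩
      ((X - 1ℚ) * (c 2 * (Q₂ - 1ℚ)) - (1ℚ - p) * (cⱼ * (X - 1ℚ)) * (Q₂ - 1ℚ)) * Q₂
        ≡⟨ cong₂ (λ x y → ((X - 1ℚ) * x - (1ℚ - p) * y * (Q₂ - 1ℚ)) * Q₂) c₂-spec cⱼ[X-1]≡X ⟩
      ((X - 1ℚ) * Q₂ - (1ℚ - p) * X * (Q₂ - 1ℚ)) * Q₂
        ≡⟨ certificate X Q₂ Qd Qe p E ⟩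
      C ∎
      where
      open ≡-Reasoning
      regroup : ∀ c₂ c p X Q₂ → (c₂ * ((X - 1ℚ) * (Q₂ - 1ℚ)) - (1ℚ - p) * c * ((X - 1ℚ) * (Q₂ - 1ℚ))) * Q₂
        ≡ ((X - 1ℚ) * (c₂ * (Q₂ - 1ℚ)) - (1ℚ - p) * (c * (X - 1ℚ)) * (Q₂ - 1ℚ)) * Q₂
      regroup = solve-∀ ℚ-ring
      certificate : ∀ X Q₂ Qd Qe p E → ((X - 1ℚ) * Q₂ - (1ℚ - p) * X * (Q₂ - 1ℚ)) * Q₂
        ≡ X * (Q₂ - 1ℚ) * ((1ℚ - (Qd - 1ℚ) * (Qe - 1ℚ) * E)
                           + ((Qd - 1ℚ - Q₂) * (Qe - 1ℚ) + Q₂ * (Qe - (1ℚ + 1ℚ))) * E)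
          + (X - Q₂ * Q₂) + Q₂ * X * (Q₂ - 1ℚ) * (p + E)
      certificate = solve-∀ ℚ-ring
    4≤d : 4 ℕ.≤ suc (suc e)
    4≤d = ℕ.s≤s (ℕ.s≤s (ℕ.≤-trans 2≤j j≤e))
    0≤Qd-1-Q₂ : 0ℚ ≤ Qd - 1ℚ - Q₂
    0≤Qd-1-Q₂ = begin
      0ℚ                       ≤⟨ ≤-from-difference (certificate Q₂)
                                    (+-mono-≤ (+-mono-≤ (*-nonNeg 0≤Q₂-2 0≤Q₂-1) (*-nonNeg (nonNegative⁻¹ (1ℚ + 1ℚ)) 0≤Q₂-2))
                                              (nonNegative⁻¹ 1ℚ)) ⟩
      Q₂ * Q₂ - 1ℚ - Q₂        ≤⟨ +-monoˡ-≤ (- Q₂) (+-monoˡ-≤ (- 1ℚ) (Q⁴≤Q^ 4≤d)) ⟩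
      Qd - 1ℚ - Q₂             ∎
      where
      open ≤-Reasoning
      0≤Q₂-2 : 0ℚ ≤ Q₂ - (1ℚ + 1ℚ)
      0≤Q₂-2 = difference-nonNeg (2≤Q^ 1)
      0≤Q₂-1 : 0ℚ ≤ Q₂ - 1ℚ
      0≤Q₂-1 = difference-nonNeg (1≤Q^ 2)
      certificate : ∀ x → x * x - 1ℚ - x - 0ℚ ≡ (x - (1ℚ + 1ℚ)) * (x - 1ℚ) + (1ℚ + 1ℚ) * (x - (1ℚ + 1ℚ)) + 1ℚ
      certificate = solve-∀ ℚ-ring
    0≤C : 0ℚ ≤ C
    0≤C = +-mono-≤ (+-mono-≤
      (*-nonNeg (*-nonNeg (0≤Q^ (suc (suc j))) (difference-nonNeg (1≤Q^ 2)))
        (+-mono-≤ (difference-nonNeg (∣P∣-bound₂ j≤e))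
                  (*-nonNeg (+-mono-≤ (*-nonNeg 0≤Qd-1-Q₂ (difference-nonNeg (1≤Q^ (suc e))))
                                      (*-nonNeg (0≤Q^ 2) (difference-nonNeg (2≤Q^ e))))
                            (0≤∣p∣ p))))
      (difference-nonNeg (Q⁴≤Q^ (ℕ.s≤s (ℕ.s≤s 2≤j)))))
      (*-nonNeg (*-nonNeg (*-nonNeg (0≤Q^ 2) (0≤Q^ (suc (suc j)))) (difference-nonNeg (1≤Q^ 2))) (0≤p+∣p∣ p))
    0≤Z : 0ℚ ≤ Z
    0≤Z = ≤-by-positive-factor (0<-from-1≤ (1≤Q^ 2)) (begin
      0ℚ * Q₂   ≡⟨ *-zeroˡ Q₂ ⟩
      0ℚ        ≤⟨ 0≤C ⟩
      C         ≡⟨ Z*Q₂≡C ⟨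
      Z * Q₂    ∎)
      where open ≤-Reasoning

  Q^≢-Q^ : ∀ n → Q ^ n ≢ - (Q ^ n)
  Q^≢-Q^ n Q^≡-Q^ = contradiction 2≤0 λ { (*≤* (ℤ.+≤+ ())) }
    where
    open ≤-Reasoning
    2≤0 : 1ℚ + 1ℚ ≤ 0ℚ
    2≤0 = begin
      1ℚ + 1ℚ             ≤⟨ +-mono-≤ (1≤Q^ n) (1≤Q^ n) ⟩
      Q ^ n + Q ^ n       ≡⟨ cong (λ x → Q ^ n + x) Q^≡-Q^ ⟩
      Q ^ n + - (Q ^ n)   ≡⟨ +-inverseʳ (Q ^ n) ⟩
      0ℚ                  ∎

  b¹≡-Q¹ : b ^ 1 ≡ - (Q ^ 1)
  b¹≡-Q¹ = trans (cong (_* 1ℚ) b≡-Q) (sym (neg-distribˡ-* Q 1ℚ))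

  b³≡-Q³ : b ^ 3 ≡ - (Q ^ 3)
  b³≡-Q³ = trans (cong (λ x → x * (x * (x * 1ℚ))) b≡-Q) (cube-of-negation Q)
    where
    cube-of-negation : ∀ x → - x * (- x * (- x * 1ℚ)) ≡ - (x * (x * (x * 1ℚ)))
    cube-of-negation = solve-∀ ℚ-ring

  v≤v₂ : ∀ e j → suc j ℕ.≤ suc (suc e) → v (suc (suc e)) (suc j) ≤ v (suc (suc e)) 2
  v≤v₂ e j j<d with b^≡±Q^ (suc j)
  ... | inj₂ b^≡-Q^ = ≤-trans (v≤c₂-odd (ℕ.s≤s⁻¹ j<d) (ℕ.s≤s ℕ.z≤n) b^≡-Q^) (c₂≤v₂ e)
  v≤v₂ e 0 _ | inj₁ b¹≡Q¹ = contradiction (trans (sym b¹≡Q¹) b¹≡-Q¹) (Q^≢-Q^ 1)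
  v≤v₂ e 1 _ | inj₁ _ = ≤-refl
  v≤v₂ e 2 _ | inj₁ b³≡Q³ = contradiction (trans (sym b³≡Q³) b³≡-Q³) (Q^≢-Q^ 3)
  v≤v₂ e (suc (suc (suc j))) (ℕ.s≤s (ℕ.s≤s 2+j≤e)) | inj₁ b^≡Q^ =
    ≤-trans (v≤c₂-even 2+j≤e (ℕ.s≤s (ℕ.s≤s ℕ.z≤n)) b^≡Q^) (c₂≤v₂ e)

  1≤b^d*b^d : ∀ d → 1ℚ ≤ b ^ d * b ^ d
  1≤b^d*b^d d = ≤-trans (1≤Q^ (d ℕ.+ d)) (≤-reflexive (trans (^-homo-* Q d d) (sym square)))
    where
    square : b ^ d * b ^ d ≡ Q ^ d * Q ^ d
    square with b^≡±Q^ d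
    ... | inj₁ b^≡Q^ = cong₂ _*_ b^≡Q^ b^≡Q^
    ... | inj₂ b^≡-Q^ = trans (cong₂ _*_ b^≡-Q^ b^≡-Q^) (product-of-negations (Q ^ d) (Q ^ d))
      where
      product-of-negations : ∀ x y → - x * - y ≡ x * y
      product-of-negations = solve-∀ ℚ-ring

  ratio≤ratio₂ : ∀ {d} → 2 ℕ.≤ d → ∀ j → 1 ℕ.≤ j → j ℕ.≤ d → ratio q d j ≤ ratio q d 2
  ratio≤ratio₂ {suc (suc e)} (ℕ.s≤s (ℕ.s≤s ℕ.z≤n)) (suc j) _ j<d =
    ≤-by-positive-factor (0<-from-1≤ (1≤b^d*b^d d)) (begin
    ratio q d (suc j) * D²   ≡⟨ ratio-scaled j<d ⟩
    (D² - 1ℚ) * v d (suc j)  ≤⟨ *-monoˡ-≤-nonNeg (D² - 1ℚ) {{nonNegative (difference-nonNeg (1≤b^d*b^d d))}}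
                                                 (v≤v₂ e j j<d) ⟩
    (D² - 1ℚ) * v d 2        ≡⟨ ratio-scaled {d} {1} (ℕ.s≤s (ℕ.s≤s ℕ.z≤n)) ⟨
    ratio q d 2 * D²         ∎)
    where
    open ≤-Reasoning
    d : ℕ
    d = suc (suc e)
    D² : ℚ
    D² = b ^ d * b ^ d

maxFrom1≡ : ∀ f n → 2 ℕ.≤ n → (∀ j → 1 ℕ.≤ j → j ℕ.≤ n → f j ≤ f 2) → maxFrom1 f n ≡ f 2
maxFrom1≡ f 1 (ℕ.s≤s ()) _
maxFrom1≡ f 2 _ f≤f₂ = p≤q⇒p⊔q≡q (f≤f₂ 1 (ℕ.s≤s ℕ.z≤n) (ℕ.s≤s ℕ.z≤n))
maxFrom1≡ f (suc (suc (suc n))) _ f≤f₂ =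
  trans (cong (_⊔ f (suc (suc (suc n))))
              (maxFrom1≡ f (suc (suc n)) (ℕ.s≤s (ℕ.s≤s ℕ.z≤n))
                         (λ j 1≤j j≤n → f≤f₂ j 1≤j (ℕ.m≤n⇒m≤1+n j≤n))))
        (p≥q⇒p⊔q≡p (f≤f₂ (suc (suc (suc n))) (ℕ.s≤s ℕ.z≤n) ℕ.≤-refl))

prime-power≥2 : ∀ {q} → (∃₂ λ p e → Prime p × 1 ℕ.≤ e × q ≡ p ℕ.^ e) → 2 ℕ.≤ q
prime-power≥2 (p , e , p-prime , 1≤e , refl) =
  ℕ.≤-trans (ℕ.nonTrivial⇒n>1 p) (ℕ.≤-trans (ℕ.≤-reflexive (sym (ℕ.*-identityʳ p))) (ℕ.^-monoʳ-≤ p 1≤e))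
  where
  instance
    p-nonTrivial : ℕ.NonTrivial p
    p-nonTrivial = prime⇒nonTrivial p-prime
    p-nonZero : ℕ.NonZero p
    p-nonZero = ℕ.nonTrivial⇒nonZero p

proposition5p4 : (q d : ℕ) → (∃₂ λ p e → Prime p × 1 ℕ.≤ e × q ≡ p ℕ.^ e) → 2 ℕ.≤ d →
    maxFrom1 (ratio q d) d ≡ ratio q d 2
proposition5p4 q d q-prime-power 2≤d =
  maxFrom1≡ (ratio q d) d 2≤d (Hermitian.ratio≤ratio₂ q (prime-power≥2 q-prime-power) 2≤d)
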